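{- Let $A=\{a,b\}$, let $m=\mathit{MinPal}(A^{\mathbb N}_{\mathrm{cl}})$, and let $\omega\in A^{\mathbb N}$ be closed under reversal with $\#\mathrm{PAL}(\omega)=m$. If $\#\mathrm{PAL}(\omega)\le 12$, then both $aa$ and $bb$ are factors of $\omega$.
   Context: $A^{\mathbb N}_{\mathrm{cl}}$ is the set of infinite words over $A$ closed under reversal (the reversal of every factor is a factor). $\mathrm{PAL}(\omega)$ is the set of palindromic factors of $\omega$ including the empty word, and $\mathit{MinPal}(X)=\inf\{\#\mathrm{PAL}(\omega)\mid\omega\in X\}$. -}

module Defs where

open import Data.Nat using (ℕ; _+_)
open import Data.List using (List; length; reverse; applyUpTo)
open import Data.List.Membership.Propositional using (_∈_)
open import Data.List.Relation.Unary.Unique.Propositional using (Unique)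
open import Data.Product using (Σ; ∃; _×_)
open import Function.Bundles using (_⇔_)
open import Relation.Binary.PropositionalEquality using (_≡_)

data Letter : Set where
  a b : Letter

Word : Set
Word = List Letter

InfWord : Set
InfWord = ℕ → Letter

slice : InfWord → ℕ → ℕ → Word
slice ω i n = applyUpTo (λ j → ω (i + j)) n

Factor : Word → InfWord → Set
Factor w ω = ∃ λ i → slice ω i (length w) ≡ w

ClosedUnderReversal : InfWord → Set
ClosedUnderReversal ω = ∀ w → Factor w ω → Factor (reverse w) ω

IsPal : Word → Set
IsPal w = reverse w ≡ w

-- PAL(ω) = palindromic factors of ω (the empty word included, as it is a factor).
_∈PAL_ : Word → InfWord → Set
w ∈PAL ω = IsPal w × Factor w ω

PalCount : InfWord → ℕ → Set
PalCount ω n = Σ (List Word) λ L →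
  (length L ≡ n) × Unique L × (∀ w → (w ∈ L) ⇔ (w ∈PAL ω))

-- Applied to the
-- prefix of length 13 of ω, whose palindromic factors lie in PAL(ω), this
-- contradicts #PAL(ω) ≤ 12 unless aa and bb occur in that prefix.
module Submission where

open import Defs
open import Data.Nat using (ℕ; zero; suc; _+_; _≤_; _≤?_; z≤n; s≤s)
open import Data.Nat.Properties using (≤-trans; <-irrefl)
open import Data.List using (List; []; _∷_; [_]; _++_; map; filter; deduplicate; length; reverse; applyUpTo)
open import Data.List.Properties using (≡-dec; length-applyUpTo)
open import Data.List.Membership.Propositional using (_∈_)
open import Data.List.Membership.Propositional.Properties using (∈-map⁻; ∈-map⁺; ∈-++⁻; ∈-++⁺ˡ; ∈-++⁺ʳ; ∈-filter⁻; ∈-deduplicate⁻)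
import Data.List.Membership.DecPropositional as DecMembership
open import Data.List.Relation.Unary.Any using (here; there)
open import Data.List.Relation.Unary.All as All using ()
open import Data.List.Relation.Unary.All.Properties using (all⁺)
open import Data.Bool using (T)
open import Data.Bool.ListAction using (all)
open import Data.List.Relation.Unary.Unique.Propositional using (Unique; _∷_)
open import Data.List.Relation.Unary.Unique.DecPropositional.Properties using (deduplicate-!)
open import Data.Product using (_×_; _,_; ∃)
open import Data.Sum using (_⊎_; inj₁; inj₂)
open import Data.Empty using (⊥-elim)
open import Function using (_∘_; _$_)
open import Function.Bundles using (Equivalence)
open import Relation.Nullary using (Dec; yes; no)
open import Relation.Nullary.Decidable using (isYes; toWitness; _⊎-dec_)
open import Relation.Unary using (Decidable)
open import Relation.Binary.PropositionalEquality using (_≡_; _≢_; refl; cong; subst)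

module _ {A : Set} where

  remove : {x : A} (ys : List A) → x ∈ ys → List A
  remove (_ ∷ ys) (here _)  = ys
  remove (y ∷ ys) (there p) = y ∷ remove ys p

  length-remove : {x : A} (ys : List A) (p : x ∈ ys) → suc (length (remove ys p)) ≡ length ys
  length-remove (_ ∷ ys) (here _)  = refl
  length-remove (_ ∷ ys) (there p) = cong suc (length-remove ys p)

  ∈-remove : {x z : A} (ys : List A) (p : x ∈ ys) → z ∈ ys → x ≢ z → z ∈ remove ys p
  ∈-remove (_ ∷ _)  (here refl) (here refl) x≢z = ⊥-elim (x≢z refl)
  ∈-remove (_ ∷ _)  (here _)    (there q)   _   = q
  ∈-remove (_ ∷ _)  (there _)   (here refl) _   = here refl
  ∈-remove (_ ∷ ys) (there p)   (there q)   x≢z = there (∈-remove ys p q x≢z)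

  Unique-⊆⇒length≤ : {xs ys : List A} → Unique xs → (∀ {z} → z ∈ xs → z ∈ ys) →
                     length xs ≤ length ys
  Unique-⊆⇒length≤ {[]}     _            _  = z≤n
  Unique-⊆⇒length≤ {x ∷ xs} {ys} (x∉xs ∷ u) xs⊆ys =
    subst (_ ≤_) (length-remove ys x∈ys) $ s≤s $
      Unique-⊆⇒length≤ u λ z∈xs → ∈-remove ys x∈ys (xs⊆ys (there z∈xs)) (All.lookup x∉xs z∈xs)
    where
    x∈ys : x ∈ ys
    x∈ys = xs⊆ys (here refl)

  prefixes : List A → List (List A)
  prefixes []       = [ [] ]
  prefixes (x ∷ xs) = [] ∷ map (x ∷_) (prefixes xs)

  factors : List A → List (List A)
  factors []       = [ [] ]
  factors (x ∷ xs) = prefixes (x ∷ xs) ++ factors xs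

  ∈-prefixes-applyUpTo : ∀ (f : ℕ → A) k {z} → z ∈ prefixes (applyUpTo f k) →
                         applyUpTo f (length z) ≡ z
  ∈-prefixes-applyUpTo f zero    (here refl) = refl
  ∈-prefixes-applyUpTo f (suc k) (here refl) = refl
  ∈-prefixes-applyUpTo f (suc k) (there z∈) with ∈-map⁻ (f 0 ∷_) z∈
  ... | z′ , z′∈ , refl = cong (f 0 ∷_) (∈-prefixes-applyUpTo (λ j → f (suc j)) k z′∈)

  ∈-factors-applyUpTo : ∀ (f : ℕ → A) k {z} → z ∈ factors (applyUpTo f k) →
                        ∃ λ i → applyUpTo (λ j → f (i + j)) (length z) ≡ z
  ∈-factors-applyUpTo f zero    (here refl) = 0 , refl
  ∈-factors-applyUpTo f (suc k) z∈ with ∈-++⁻ (prefixes (applyUpTo f (suc k))) z∈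
  ... | inj₁ z∈prefixes = 0 , ∈-prefixes-applyUpTo f (suc k) z∈prefixes
  ... | inj₂ z∈factors with ∈-factors-applyUpTo (λ j → f (suc j)) k z∈factors
  ...   | i , eq = suc i , eq

_≟ˡ_ : (x y : Letter) → Dec (x ≡ y)
a ≟ˡ a = yes refl
a ≟ˡ b = no λ ()
b ≟ˡ a = no λ ()
b ≟ˡ b = yes refl

_≟ʷ_ : (v w : Word) → Dec (v ≡ w)
_≟ʷ_ = ≡-dec _≟ˡ_

open DecMembership _≟ʷ_ using (_∈?_)

isPal? : Decidable IsPal
isPal? w = reverse w ≟ʷ w

palFactors : Word → List Word
palFactors w = deduplicate _≟ʷ_ (filter isPal? (factors w))

words : ℕ → List Word
words zero    = [ [] ]
words (suc n) = map (a ∷_) (words n) ++ map (b ∷_) (words n)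

∈-words : ∀ w → w ∈ words (length w)
∈-words []      = here refl
∈-words (a ∷ w) = ∈-++⁺ˡ (∈-map⁺ (a ∷_) (∈-words w))
∈-words (b ∷ w) = ∈-++⁺ʳ _ (∈-map⁺ (b ∷_) (∈-words w))

all-words : ∀ {P : Word → Set} (P? : Decidable P) n → T (all (isYes ∘ P?) (words n)) →
            ∀ w → length w ≡ n → P w
all-words P? n ok w refl =
  toWitness (All.lookup (all⁺ (isYes ∘ P?) (words n) ok) (∈-words w))

FactorOrPalRich : Word → ℕ → Word → Set
FactorOrPalRich t k w = t ∈ factors w ⊎ k ≤ length (palFactors w)

factorOrPalRich? : ∀ t k → Decidable (FactorOrPalRich t k)
factorOrPalRich? t k w = (t ∈? factors w) ⊎-dec (k ≤? length (palFactors w))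

length13⇒aa-or-13-palindromes : ∀ w → length w ≡ 13 → FactorOrPalRich (a ∷ a ∷ []) 13 w
length13⇒aa-or-13-palindromes = all-words (factorOrPalRich? (a ∷ a ∷ []) 13) 13 _

length13⇒bb-or-13-palindromes : ∀ w → length w ≡ 13 → FactorOrPalRich (b ∷ b ∷ []) 13 w
length13⇒bb-or-13-palindromes = all-words (factorOrPalRich? (b ∷ b ∷ []) 13) 13 _

module _ (ω : InfWord) where

  ∈-factors-prefix⇒Factor : ∀ k {z} → z ∈ factors (slice ω 0 k) → Factor z ω
  ∈-factors-prefix⇒Factor = ∈-factors-applyUpTo ω

  ∈-palFactors-prefix⇒∈PAL : ∀ k {z} → z ∈ palFactors (slice ω 0 k) → z ∈PAL ω
  ∈-palFactors-prefix⇒∈PAL k z∈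
    with ∈-filter⁻ isPal? (∈-deduplicate⁻ _≟ʷ_ (filter isPal? (factors (slice ω 0 k))) z∈)
  ... | z∈factors , pal = pal , ∈-factors-prefix⇒Factor k z∈factors

  PalCount⇒palFactors-prefix≤ : ∀ {n} → PalCount ω n → ∀ k → length (palFactors (slice ω 0 k)) ≤ n
  PalCount⇒palFactors-prefix≤ (L , refl , _ , L⇔PAL) k =
    Unique-⊆⇒length≤ (deduplicate-! _≟ʷ_ _) λ {z} z∈ →
      Equivalence.from (L⇔PAL z) (∈-palFactors-prefix⇒∈PAL k z∈)

mainTheorem15 : (ω : InfWord) (n : ℕ)
    → ClosedUnderReversal ω
    → PalCount ω n
    → (∀ ω′ n′ → ClosedUnderReversal ω′ → PalCount ω′ n′ → n ≤ n′)
    → n ≤ 12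
    → Factor (a ∷ a ∷ []) ω × Factor (b ∷ b ∷ []) ω
mainTheorem15 ω n _ #PAL≡n _ n≤12 =
  occurs (length13⇒aa-or-13-palindromes w (length-applyUpTo ω 13)) ,
  occurs (length13⇒bb-or-13-palindromes w (length-applyUpTo ω 13))
  where
  w : Word
  w = slice ω 0 13
  occurs : ∀ {t} → FactorOrPalRich t 13 w → Factor t ω
  occurs (inj₁ t∈w)   = ∈-factors-prefix⇒Factor ω 13 t∈w
  occurs (inj₂ 13≤#w) = ⊥-elim $ <-irrefl refl $
    ≤-trans 13≤#w (≤-trans (PalCount⇒palFactors-prefix≤ ω #PAL≡n 13) n≤12)
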